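{- Let $(I,C)$ be a hypergraph of agents and contracts in which every agent $i$ has a non-empty-valued Plott choice function $f_i$ on $C(i)$, and every agent has an autarkic contract. A meta-stable system $S\subseteq C$ is minimal if and only if every contract $s\in S$ has a participant $i\in P(s)$ with $S(i)=\{s\}$.
   Context: Finite agents $I$, finite contracts $C$, each $c\in C$ with nonempty participant set $P(c)\subseteq I$; a contract $c$ is autarkic if $P(c)=\{i\}$ is a singleton. $S(i)=\{s\in S:i\in P(s)\}$. A choice function $f$ satisfies $f(A)\subseteq A$; Plott: $f(A\cup B)=f(f(A)\cup B)$; non-empty-valued: $f(A)\ne\emptyset$ for $A\ne\emptyset$. An element $d$ dominates $A$ relative to $f$ if $A=\emptyset$ or some $a\in A$ has $a\notin f(\{a,d\})$. A contract $d$ dominates $S$ if for every $i\in P(d)$, $d$ dominates $S(i)$ relative to $f_i$. $S$ is meta-stable if no contract of $C$ dominates it, and a meta-stable system is minimal if no proper subset of it is meta-stable. -}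

module Defs where

open import Data.Nat using (ℕ)
open import Data.Fin using (Fin)
open import Data.Fin.Subset
open import Data.Vec using (tabulate; lookup)
open import Data.Product using (Σ; ∃; _×_; _,_)
open import Data.Sum using (_⊎_)
open import Relation.Nullary using (¬_)
open import Relation.Binary.PropositionalEquality using (_≡_)

-- Agents are Fin n, contracts are Fin m.
-- The participant map P assigns to each contract a subset of agents.

C[_] : ∀ {n m} → (Fin m → Subset n) → Fin n → Subset m
C[ P ] i = tabulate (λ c → lookup (P c) i)

restrict : ∀ {n m} → (Fin m → Subset n) → Subset m → Fin n → Subset m
restrict P S i = S ∩ C[ P ] i

NonemptyParticipants : ∀ {n m} → (Fin m → Subset n) → Set
NonemptyParticipants P = ∀ c → Nonempty (P c)

HasAutarkic : ∀ {n m} → (Fin m → Subset n) → Set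
HasAutarkic {n} {m} P = ∀ (i : Fin n) → ∃ λ (c : Fin m) → P c ≡ ⁅ i ⁆

IsChoiceOn : ∀ {m} → Subset m → (Subset m → Subset m) → Set
IsChoiceOn D g = ∀ A → A ⊆ D → g A ⊆ A

PlottOn : ∀ {m} → Subset m → (Subset m → Subset m) → Set
PlottOn D g = ∀ A B → A ⊆ D → B ⊆ D → g (A ∪ B) ≡ g (g A ∪ B)

NonEmptyValuedOn : ∀ {m} → Subset m → (Subset m → Subset m) → Set
NonEmptyValuedOn D g = ∀ A → A ⊆ D → Nonempty A → Nonempty (g A)

DominatesSet : ∀ {m} → (Subset m → Subset m) → Fin m → Subset m → Set
DominatesSet g d A = A ≡ ⊥ ⊎ (∃ λ a → a ∈ A × a ∉ g (⁅ a ⁆ ∪ ⁅ d ⁆))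

Dominates : ∀ {n m} → (Fin m → Subset n) → (Fin n → Subset m → Subset m) →
            Fin m → Subset m → Set
Dominates P f d S = ∀ i → i ∈ P d → DominatesSet (f i) d (restrict P S i)

MetaStable : ∀ {n m} → (Fin m → Subset n) → (Fin n → Subset m → Subset m) →
             Subset m → Set
MetaStable P f S = ∀ d → ¬ Dominates P f d S

MinimalMetaStable : ∀ {n m} → (Fin m → Subset n) → (Fin n → Subset m → Subset m) →
                    Subset m → Set
MinimalMetaStable P f S = MetaStable P f S × (∀ T → T ⊂ S → ¬ MetaStable P f T)

{-# OPTIONS --safe #-}
module Submission where

-- In a meta-stable system every agent i holds some contract, since otherwise i's autarkic
-- contract dominates it. Hence if s is the only contract of one of its participants, no
-- meta-stable subsystem can omit s. Conversely, if every participant of s holds another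
-- contract of S as well, then S - s is still meta-stable: a contract dominating S - s
-- dominates S too, because no agent's holding becomes empty by dropping s.

open import Defs
open import Data.Nat using (ℕ)
open import Data.Bool.Properties using () renaming (_≟_ to _≟ᵇ_)
open import Data.Fin using (Fin; _≟_)
open import Data.Fin.Properties using (any?)
open import Data.Fin.Subset using (Subset; _∈_; _∉_; ⁅_⁆; _-_; ⊥; _⊆_)
open import Data.Fin.Subset.Properties
  using (_∈?_; x∈p∩q⁺; x∈p∩q⁻; Empty-unique; ∉⊥; x∈⁅x⁆; x∈⁅y⁆⇒x≡y; ⊆-antisym;
         x∈p∧x≢y⇒x∈p-y; p─q⊆p; x∈p⇒p-x⊂p)
open import Data.Vec using (lookup)
open import Data.Vec.Properties using ([]=⇒lookup; lookup⇒[]=; lookup∘tabulate; ≡-dec)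
open import Data.Product using (∃; _×_; _,_; proj₁; proj₂)
open import Data.Sum using (_⊎_; inj₁; inj₂)
open import Data.Empty using (⊥-elim)
open import Function.Bundles using (_⇔_; mk⇔)
open import Relation.Nullary using (yes; no; _×-dec_)
open import Relation.Binary.PropositionalEquality using (_≡_; _≢_; refl; sym; trans; subst)

module _ {m : ℕ} where

  p≡⊥⇒x∉p : ∀ {p : Subset m} {x} → p ≡ ⊥ → x ∉ p
  p≡⊥⇒x∉p refl = ∉⊥

  p⊆⁅x⁆⇒p≡⊥⊎p≡⁅x⁆ : ∀ {p : Subset m} {x} → p ⊆ ⁅ x ⁆ → p ≡ ⊥ ⊎ p ≡ ⁅ x ⁆
  p⊆⁅x⁆⇒p≡⊥⊎p≡⁅x⁆ {p} {x} p⊆⁅x⁆ with x ∈? p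
  ... | yes x∈p = inj₂ (⊆-antisym p⊆⁅x⁆ λ y∈⁅x⁆ → subst (_∈ p) (sym (x∈⁅y⁆⇒x≡y x y∈⁅x⁆)) x∈p)
  ... | no x∉p = inj₁ (Empty-unique λ { (y , y∈p) → x∉p (subst (_∈ p) (x∈⁅y⁆⇒x≡y x (p⊆⁅x⁆ y∈p)) y∈p) })

  p⊆⁅x⁆∧x∉p⇒p≡⊥ : ∀ {p : Subset m} {x} → p ⊆ ⁅ x ⁆ → x ∉ p → p ≡ ⊥
  p⊆⁅x⁆∧x∉p⇒p≡⊥ p⊆⁅x⁆ x∉p with p⊆⁅x⁆⇒p≡⊥⊎p≡⁅x⁆ p⊆⁅x⁆
  ... | inj₁ p≡⊥ = p≡⊥
  ... | inj₂ refl = ⊥-elim (x∉p (x∈⁅x⁆ _))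

  DominatesSet-mono : ∀ (g : Subset m → Subset m) d {A B} →
    A ⊆ B → (A ≡ ⊥ → B ≡ ⊥) → DominatesSet g d A → DominatesSet g d B
  DominatesSet-mono _ _ _ empty (inj₁ A≡⊥) = inj₁ (empty A≡⊥)
  DominatesSet-mono _ _ A⊆B empty (inj₂ (a , a∈A , a-rejected)) = inj₂ (a , A⊆B a∈A , a-rejected)

module _ {n m : ℕ} (P : Fin m → Subset n) where

  ∈P⇒∈C[] : ∀ {i c} → i ∈ P c → c ∈ C[ P ] i
  ∈P⇒∈C[] {i} {c} i∈Pc =
    lookup⇒[]= c (C[ P ] i) (trans (lookup∘tabulate (λ c → lookup (P c) i) c) ([]=⇒lookup i∈Pc))

  ∈C[]⇒∈P : ∀ {i c} → c ∈ C[ P ] i → i ∈ P c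
  ∈C[]⇒∈P {i} {c} c∈Ci =
    lookup⇒[]= i (P c) (trans (sym (lookup∘tabulate (λ c → lookup (P c) i) c)) ([]=⇒lookup c∈Ci))

  ∈-restrict⁺ : ∀ {S i c} → c ∈ S → i ∈ P c → c ∈ restrict P S i
  ∈-restrict⁺ c∈S i∈Pc = x∈p∩q⁺ (c∈S , ∈P⇒∈C[] i∈Pc)

  ∈-restrict⁻ : ∀ {S i c} → c ∈ restrict P S i → c ∈ S × i ∈ P c
  ∈-restrict⁻ {S} {i} c∈Si with x∈p∩q⁻ S (C[ P ] i) c∈Si
  ... | c∈S , c∈Ci = c∈S , ∈C[]⇒∈P c∈Ci

  restrict-mono : ∀ {S T} i → T ⊆ S → restrict P T i ⊆ restrict P S i
  restrict-mono i T⊆S c∈Ti with ∈-restrict⁻ c∈Ti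
  ... | c∈T , i∈Pc = ∈-restrict⁺ (T⊆S c∈T) i∈Pc

  restrict-remove≡⊥⇒⊆⁅⁆ : ∀ S s i → restrict P (S - s) i ≡ ⊥ → restrict P S i ⊆ ⁅ s ⁆
  restrict-remove≡⊥⇒⊆⁅⁆ S s i S-s≡⊥ {c} c∈Si with c ≟ s | ∈-restrict⁻ c∈Si
  ... | yes refl | _ = x∈⁅x⁆ c
  ... | no c≢s | c∈S , i∈Pc = ⊥-elim (p≡⊥⇒x∉p S-s≡⊥ (∈-restrict⁺ (x∈p∧x≢y⇒x∈p-y c∈S c≢s) i∈Pc))

  restrict≡⁅s⁆⇒restrict≡⊥ : ∀ {S T s} i → restrict P S i ≡ ⁅ s ⁆ → T ⊆ S → s ∉ T → restrict P T i ≡ ⊥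
  restrict≡⁅s⁆⇒restrict≡⊥ i Si≡⁅s⁆ T⊆S s∉T =
    p⊆⁅x⁆∧x∉p⇒p≡⊥ (subst (_ ⊆_) Si≡⁅s⁆ (restrict-mono i T⊆S)) (λ s∈Ti → s∉T (proj₁ (∈-restrict⁻ s∈Ti)))

  module _ (f : Fin n → Subset m → Subset m) where

    Dominates-remove : ∀ {d S s} → (∀ i → i ∈ P s → restrict P S i ≢ ⁅ s ⁆) →
      Dominates P f d (S - s) → Dominates P f d S
    Dominates-remove {S = S} {s} notSole dom i i∈Pd =
      DominatesSet-mono (f i) _ (restrict-mono i (p─q⊆p S ⁅ s ⁆)) S-s≡⊥⇒S≡⊥ (dom i i∈Pd)
      where
      S-s≡⊥⇒S≡⊥ : restrict P (S - s) i ≡ ⊥ → restrict P S i ≡ ⊥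
      S-s≡⊥⇒S≡⊥ S-s≡⊥ with p⊆⁅x⁆⇒p≡⊥⊎p≡⁅x⁆ (restrict-remove≡⊥⇒⊆⁅⁆ S s i S-s≡⊥)
      ... | inj₁ Si≡⊥ = Si≡⊥
      ... | inj₂ Si≡⁅s⁆ =
        ⊥-elim (notSole i (proj₂ (∈-restrict⁻ (subst (s ∈_) (sym Si≡⁅s⁆) (x∈⁅x⁆ s)))) Si≡⁅s⁆)

    MetaStable-remove : ∀ {S s} → MetaStable P f S → (∀ i → i ∈ P s → restrict P S i ≢ ⁅ s ⁆) →
      MetaStable P f (S - s)
    MetaStable-remove ms notSole d dom = ms d (Dominates-remove notSole dom)

    autarkic-Dominates : ∀ {T c i} → P c ≡ ⁅ i ⁆ → restrict P T i ≡ ⊥ → Dominates P f c T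
    autarkic-Dominates {i = i} Pc≡⁅i⁆ Ti≡⊥ j j∈Pc with x∈⁅y⁆⇒x≡y i (subst (j ∈_) Pc≡⁅i⁆ j∈Pc)
    ... | refl = inj₁ Ti≡⊥

    MetaStable⇒restrict≢⊥ : ∀ {T} → HasAutarkic P → MetaStable P f T → ∀ i → restrict P T i ≢ ⊥
    MetaStable⇒restrict≢⊥ aut ms i Ti≡⊥ with aut i
    ... | c , Pc≡⁅i⁆ = ms c (autarkic-Dominates Pc≡⁅i⁆ Ti≡⊥)

proposition6p1 : ∀ {n m : ℕ} (P : Fin m → Subset n) (f : Fin n → Subset m → Subset m) →
    NonemptyParticipants P →
    (∀ i → IsChoiceOn (C[ P ] i) (f i)) →
    (∀ i → PlottOn (C[ P ] i) (f i)) →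
    (∀ i → NonEmptyValuedOn (C[ P ] i) (f i)) →
    HasAutarkic P →
    (S : Subset m) → MetaStable P f S →
    (MinimalMetaStable P f S ⇔
      (∀ s → s ∈ S → ∃ λ i → i ∈ P s × restrict P S i ≡ ⁅ s ⁆))
proposition6p1 P f _ _ _ _ aut S ms = mk⇔ minimal⇒sole sole⇒minimal
  where
  minimal⇒sole : MinimalMetaStable P f S → ∀ s → s ∈ S → ∃ λ i → i ∈ P s × restrict P S i ≡ ⁅ s ⁆
  minimal⇒sole (_ , minimal) s s∈S with any? (λ i → i ∈? P s ×-dec ≡-dec _≟ᵇ_ (restrict P S i) ⁅ s ⁆)
  ... | yes sole = sole
  ... | no noSole = ⊥-elim (minimal (S - s) (x∈p⇒p-x⊂p s∈S)
                      (MetaStable-remove P f ms λ i i∈Ps Si≡⁅s⁆ → noSole (i , i∈Ps , Si≡⁅s⁆)))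

  sole⇒minimal : (∀ s → s ∈ S → ∃ λ i → i ∈ P s × restrict P S i ≡ ⁅ s ⁆) → MinimalMetaStable P f S
  sole⇒minimal sole = ms , λ { T (T⊆S , s , s∈S , s∉T) msT →
    let (i , _ , Si≡⁅s⁆) = sole s s∈S
    in MetaStable⇒restrict≢⊥ P f aut msT i (restrict≡⁅s⁆⇒restrict≡⊥ P i Si≡⁅s⁆ T⊆S s∉T) }
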